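{- A tricycle is not (isomorphic to) the combinatorial derived matroid $\delta M$ of any matroid $M$.
   Context: For a matroid $M$ on $E$ with circuit set $\mathcal{C}$, $r(S)$ is the maximum size of a circuit-free subset of $S\subseteq E$ and $\eta(S)=|S|-r(S)$. For a family $\mathcal{X}$ of subsets of a finite set $X$: $\epsilon(\mathcal{X})=\mathcal{X}\cup\{(A_1\cup A_2)\setminus\{v\}: A_1,A_2\in\mathcal{X},\ A_1\cap A_2\notin\mathcal{X},\ v\in A_1\cap A_2\}$; ${\uparrow}\mathcal{X}=\{A\subseteq X:\exists A'\in\mathcal{X},A'\subseteq A\}$. The combinatorial derived matroid $\delta M$ is the matroid on ground set $\mathcal{C}$ whose dependent sets are the members of $\mathcal{A}=\bigcup_i\mathcal{A}_i$, where $\mathcal{A}_0=\{A\subseteq\mathcal{C}:|A|>\eta(\bigcup_{C\in A}C)\}$ and $\mathcal{A}_{i+1}={\uparrow}\epsilon(\mathcal{A}_i)$. A matroid $(E,\mathcal{C})$ is a tricycle if $\mathcal{C}=\{C_1,C_2,C_3\}$ has exactly three circuits with $C_i\cap C_j\neq\emptyset$ and $C_i\cup C_j=E$ for all $i\neq j$, and $C_1\cap C_2\cap C_3=\emptyset$. -}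

module Defs where

open import Data.Nat using (ℕ; zero; suc; _∸_; _<_; _≤_)
open import Data.Fin using (Fin; zero; suc)
open import Data.Fin.Subset
  using (Subset; _∈_; _⊆_; _∩_; _∪_; _-_; ∣_∣; Nonempty; Empty; ⊤)
  renaming (⊥ to ∅)
open import Data.Vec using (Vec; []; _∷_; lookup; tabulate)
open import Data.Bool using (if_then_else_)
open import Data.Product using (Σ; ∃; ∃-syntax; _×_; _,_)
open import Data.Sum using (_⊎_)
open import Relation.Nullary using (¬_)
open import Relation.Binary.PropositionalEquality using (_≡_; _≢_)
open import Function using (_∘_; _⇔_)
open import Function.Bundles using (_↔_; Inverse)

-- Finite matroids given by their circuits.
-- The ground set is Fin n; the (finite) set of circuits is enumerated
-- without repetition as circ : Fin m → Subset n (C2 forces injectivity).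

record Matroid (n : ℕ) : Set where
  field
    m    : ℕ
    circ : Fin m → Subset n
    C1   : ∀ i → Nonempty (circ i)
    C2   : ∀ i j → circ i ⊆ circ j → i ≡ j
    C3   : ∀ i j e → i ≢ j → e ∈ circ i → e ∈ circ j →
           ∃[ k ] circ k ⊆ (circ i ∪ circ j) - e

open Matroid public

Dependent : ∀ {n} (M : Matroid n) → Subset n → Set
Dependent M S = ∃[ i ] circ M i ⊆ S

Independent : ∀ {n} (M : Matroid n) → Subset n → Set
Independent M S = ¬ Dependent M S

IsRank : ∀ {n} (M : Matroid n) → Subset n → ℕ → Set
IsRank M S k =
  (∃[ I ] (I ⊆ S × Independent M I × ∣ I ∣ ≡ k)) ×
  (∀ I → I ⊆ S → Independent M I → ∣ I ∣ ≤ k)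

unionOver : ∀ {m n} → (Fin m → Subset n) → Subset m → Subset n
unionOver {zero}  c []      = ∅
unionOver {suc m} c (b ∷ A) = (if b then c zero else ∅) ∪ unionOver (c ∘ suc) A

-- Combinatorial derived matroid δM: ground set = circuits of M (Fin (m M)).

module _ {n : ℕ} (M : Matroid n) where

  𝒜₀ : Subset (m M) → Set
  𝒜₀ A = ∃[ k ] (IsRank M U k × (∣ U ∣ ∸ k) < ∣ A ∣)
    where U = unionOver (circ M) A

  ε : (Subset (m M) → Set) → Subset (m M) → Set
  ε 𝒳 A = 𝒳 A ⊎
    (∃[ A₁ ] ∃[ A₂ ] ∃[ v ]
       (𝒳 A₁ × 𝒳 A₂ × ¬ 𝒳 (A₁ ∩ A₂) × v ∈ A₁ × v ∈ A₂ × A ≡ (A₁ ∪ A₂) - v))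

  up : (Subset (m M) → Set) → Subset (m M) → Set
  up 𝒳 A = ∃[ A' ] (A' ⊆ A × 𝒳 A')

  𝒜 : ℕ → Subset (m M) → Set
  𝒜 zero    = 𝒜₀
  𝒜 (suc i) = up (ε (𝒜 i))

  δDependent : Subset (m M) → Set
  δDependent A = ∃[ i ] 𝒜 i A

IsTricycle : ∀ {n} → Matroid n → Set
IsTricycle {n} T =
  Σ (m T ≡ 3) λ { _≡_.refl →
      (∀ (i j : Fin 3) → i ≢ j →
         Nonempty (circ T i ∩ circ T j) × (circ T i ∪ circ T j) ≡ ⊤)
    × Empty (circ T zero ∩ circ T (suc zero) ∩ circ T (suc (suc zero))) }

image : ∀ {a b} → (Fin a ↔ Fin b) → Subset a → Subset b
image σ A = tabulate (λ e → lookup A (Inverse.from σ e))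

δIsomorphic : ∀ {n k} → Matroid n → Matroid k → Set
δIsomorphic {n} {k} M T =
  Σ (Fin (m M) ↔ Fin k) λ σ →
    ∀ (A : Subset (m M)) → δDependent M A ⇔ Dependent T (image σ A)

-- Suppose δM were a tricycle with circuits X₁, X₂, X₃ (sets of circuits of M), so that the
-- δ-dependent sets are exactly the supersets of some Xᵢ. Every δ-dependent set has at least three
-- elements. If the part Q = Xⱼ ∩ Xₖ opposite to Xᵢ has at least two elements, then Xᵢ lies in 𝒜₀
-- and no set with at most one element outside Xᵢ and not containing Xᵢ lies in 𝒜₀ (it would have
-- to contain Q). For such an X, take a basis B of U = ⋃X and N = U ─ B: comparing X with X - h and
-- with (X - h) ∪ {w} gives ∣X∣ = ∣N∣ + 1, every circuit inside U belongs to X, and all members of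
-- X except one circuit d are the fundamental circuits of the elements of N, while N ⊆ d. Circuit
-- elimination then rules out ∣X∣ ≥ 4 and makes X a theta when ∣X∣ = 3. Counting the parts Xᵢ ∩ Xⱼ
-- leaves only two thetas sharing exactly one circuit and exhausting the circuits of M, which
-- circuit elimination at a point of the shared circuit rules out.
module Submission where

open import Defs
open import Data.Nat using (ℕ; zero; suc; _+_; _∸_; _<_; _≤_; _≤?_; z≤n; s≤s)
open import Data.Nat.Properties
open import Data.Fin using (Fin; zero; suc)
import Data.Fin.Properties as Fin
open import Data.Fin.Subset
  using (Subset; inside; outside; _∈_; _∉_; _⊆_; _∩_; _∪_; _─_; _-_; ∣_∣; Nonempty; ⁅_⁆)
  renaming (⊥ to ∅)
open import Data.Fin.Subset.Properties
open import Data.Vec.Base using ([]; _∷_; here; there; lookup; tabulate)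
open import Data.Vec.Properties using (lookup∘tabulate; []=⇒lookup; lookup⇒[]=)
open import Data.Product using (Σ; ∃-syntax; _×_; _,_; proj₁; proj₂)
open import Data.Sum using (_⊎_; inj₁; inj₂; [_,_]′; swap; map₁; map₂)
open import Data.Empty using (⊥; ⊥-elim)
open import Relation.Nullary using (¬_; Dec; yes; no; contradiction)
open import Relation.Nullary.Decidable using (_×-dec_; ¬?; decidable-stable)
open import Relation.Binary.PropositionalEquality
  using (_≡_; _≢_; refl; sym; trans; cong; subst; module ≡-Reasoning)
open import Function using (_∘_; _∘′_; _$_)
open import Function.Bundles using (_↔_; Inverse; Equivalence)

private variable
  n : ℕ
  p q : Subset n
  x y : Fin n

x∈p─q⇒x∉q : ∀ {n} {p q : Subset n} {x} → x ∈ p ─ q → x ∉ q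
x∈p─q⇒x∉q {p = inside ∷ p}  {q = outside ∷ q} here ()
x∈p─q⇒x∉q {p = inside ∷ p}  {q = inside ∷ q}  {x = zero} ()
x∈p─q⇒x∉q {p = outside ∷ p} {q = inside ∷ q}  {x = zero} ()
x∈p─q⇒x∉q {p = outside ∷ p} {q = outside ∷ q} {x = zero} ()
x∈p─q⇒x∉q {p = _ ∷ p}       {q = _ ∷ q}       (there x∈) (there x∈q) = x∈p─q⇒x∉q x∈ x∈q

x∈p-y⇒x≢y : x ∈ p - y → x ≢ y
x∈p-y⇒x≢y {y = y} x∈ = x∉⁅y⁆⇒x≢y (x∈p─q⇒x∉q x∈)

x∈p∪⁅y⁆∧x≢y⇒x∈p : x ∈ p ∪ ⁅ y ⁆ → x ≢ y → x ∈ p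
x∈p∪⁅y⁆∧x≢y⇒x∈p {p = p} {y = y} x∈ x≢y with x∈p∪q⁻ p ⁅ y ⁆ x∈
... | inj₁ x∈p = x∈p
... | inj₂ x∈y = contradiction (x∈⁅y⁆⇒x≡y y x∈y) x≢y

x∈p∪⁅y⁆∧x∉p⇒x≡y : x ∈ p ∪ ⁅ y ⁆ → x ∉ p → x ≡ y
x∈p∪⁅y⁆∧x∉p⇒x≡y {p = p} {y = y} x∈ x∉p with x∈p∪q⁻ p ⁅ y ⁆ x∈
... | inj₁ x∈p = contradiction x∈p x∉p
... | inj₂ x∈y = x∈⁅y⁆⇒x≡y y x∈y

∣p─q∣+∣p∩q∣≡∣p∣ : ∀ (p q : Subset n) → ∣ p ─ q ∣ + ∣ p ∩ q ∣ ≡ ∣ p ∣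
∣p─q∣+∣p∩q∣≡∣p∣ []            []            = refl
∣p─q∣+∣p∩q∣≡∣p∣ (inside ∷ p)  (inside ∷ q)  = trans (+-suc ∣ p ─ q ∣ ∣ p ∩ q ∣) (cong suc (∣p─q∣+∣p∩q∣≡∣p∣ p q))
∣p─q∣+∣p∩q∣≡∣p∣ (inside ∷ p)  (outside ∷ q) = cong suc (∣p─q∣+∣p∩q∣≡∣p∣ p q)
∣p─q∣+∣p∩q∣≡∣p∣ (outside ∷ p) (inside ∷ q)  = ∣p─q∣+∣p∩q∣≡∣p∣ p q
∣p─q∣+∣p∩q∣≡∣p∣ (outside ∷ p) (outside ∷ q) = ∣p─q∣+∣p∩q∣≡∣p∣ p q

∣p─q∣≡∣p∣∸∣p∩q∣ : ∀ (p q : Subset n) → ∣ p ─ q ∣ ≡ ∣ p ∣ ∸ ∣ p ∩ q ∣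
∣p─q∣≡∣p∣∸∣p∩q∣ p q = begin
  ∣ p ─ q ∣                         ≡⟨ m+n∸n≡m ∣ p ─ q ∣ ∣ p ∩ q ∣ ⟨
  ∣ p ─ q ∣ + ∣ p ∩ q ∣ ∸ ∣ p ∩ q ∣  ≡⟨ cong (_∸ ∣ p ∩ q ∣) (∣p─q∣+∣p∩q∣≡∣p∣ p q) ⟩
  ∣ p ∣ ∸ ∣ p ∩ q ∣                 ∎
  where open ≡-Reasoning

q⊆p⇒∣p─q∣≡∣p∣∸∣q∣ : q ⊆ p → ∣ p ─ q ∣ ≡ ∣ p ∣ ∸ ∣ q ∣
q⊆p⇒∣p─q∣≡∣p∣∸∣q∣ {q = q} {p = p} q⊆p = trans (∣p─q∣≡∣p∣∸∣p∩q∣ p q) (cong (λ s → ∣ p ∣ ∸ ∣ s ∣) p∩q≡q)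
  where
  p∩q≡q : p ∩ q ≡ q
  p∩q≡q = ⊆-antisym (p∩q⊆q p q) (λ x∈q → x∈p∩q⁺ (q⊆p x∈q , x∈q))

∣p∣≡∣p∩q∣+∣p∩r∣ : ∀ {p q r : Subset n} → (∀ {x} → x ∈ p → x ∈ q ⊎ x ∈ r) →
  (∀ {x} → x ∈ p → x ∈ q → x ∉ r) → ∣ p ∣ ≡ ∣ p ∩ q ∣ + ∣ p ∩ r ∣
∣p∣≡∣p∩q∣+∣p∩r∣ {p = p} {q} {r} p⊆q∪r p∩q∩r≡∅ = begin
  ∣ p ∣                  ≡⟨ ∣p─q∣+∣p∩q∣≡∣p∣ p q ⟨
  ∣ p ─ q ∣ + ∣ p ∩ q ∣  ≡⟨ cong (λ s → ∣ s ∣ + ∣ p ∩ q ∣) p─q≡p∩r ⟩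
  ∣ p ∩ r ∣ + ∣ p ∩ q ∣  ≡⟨ +-comm ∣ p ∩ r ∣ ∣ p ∩ q ∣ ⟩
  ∣ p ∩ q ∣ + ∣ p ∩ r ∣  ∎
  where
  open ≡-Reasoning
  p─q⊆p∩r : p ─ q ⊆ p ∩ r
  p─q⊆p∩r x∈ with p⊆q∪r (p─q⊆p p q x∈)
  ... | inj₁ x∈q = contradiction x∈q (x∈p─q⇒x∉q x∈)
  ... | inj₂ x∈r = x∈p∩q⁺ (p─q⊆p p q x∈ , x∈r)
  p∩r⊆p─q : p ∩ r ⊆ p ─ q
  p∩r⊆p─q x∈ with x∈p∩q⁻ p r x∈
  ... | x∈p , x∈r = x∈p∧x∉q⇒x∈p─q x∈p λ x∈q → p∩q∩r≡∅ x∈p x∈q x∈r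
  p─q≡p∩r : p ─ q ≡ p ∩ r
  p─q≡p∩r = ⊆-antisym p─q⊆p∩r p∩r⊆p─q

∣p∣≤1+∣p-x∣ : ∀ (p : Subset n) x → ∣ p ∣ ≤ suc ∣ p - x ∣
∣p∣≤1+∣p-x∣ p x = begin
  ∣ p ∣                      ≡⟨ ∣p─q∣+∣p∩q∣≡∣p∣ p ⁅ x ⁆ ⟨
  ∣ p - x ∣ + ∣ p ∩ ⁅ x ⁆ ∣   ≤⟨ +-monoʳ-≤ ∣ p - x ∣ (∣p∩q∣≤∣q∣ p ⁅ x ⁆) ⟩
  ∣ p - x ∣ + ∣ ⁅ x ⁆ ∣       ≡⟨ cong (∣ p - x ∣ +_) (∣⁅x⁆∣≡1 x) ⟩
  ∣ p - x ∣ + 1              ≡⟨ +-comm ∣ p - x ∣ 1 ⟩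
  suc ∣ p - x ∣              ∎
  where open ≤-Reasoning

x∈p⇒∣p∣≡1+∣p-x∣ : x ∈ p → ∣ p ∣ ≡ suc ∣ p - x ∣
x∈p⇒∣p∣≡1+∣p-x∣ {x = x} {p = p} x∈p = ≤-antisym (∣p∣≤1+∣p-x∣ p x) (x∈p⇒∣p-x∣<∣p∣ x∈p)

x∉p⇒∣p∣<∣p∪⁅x⁆∣ : x ∉ p → ∣ p ∣ < ∣ p ∪ ⁅ x ⁆ ∣
x∉p⇒∣p∣<∣p∪⁅x⁆∣ {x = x} {p = p} x∉p =
  p⊂q⇒∣p∣<∣q∣ (p⊆p∪q ⁅ x ⁆ , x , q⊆p∪q p ⁅ x ⁆ (x∈⁅x⁆ x) , x∉p)

∣p∣≤∣[p∪q]-x∣ : x ∈ p → y ∈ q → y ∉ p → ∣ p ∣ ≤ ∣ (p ∪ q) - x ∣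
∣p∣≤∣[p∪q]-x∣ {x = x} {p = p} {y = y} {q = q} x∈p y∈q y∉p =
  ≤-trans (∣p∣≤1+∣p-x∣ p x) (p⊂q⇒∣p∣<∣q∣ (p-x⊆[p∪q]-x , y , y∈[p∪q]-x , y∉p ∘ p─q⊆p p ⁅ x ⁆))
  where
  p-x⊆[p∪q]-x : p - x ⊆ (p ∪ q) - x
  p-x⊆[p∪q]-x z∈ = x∈p∧x≢y⇒x∈p-y (p⊆p∪q q (p─q⊆p p ⁅ x ⁆ z∈)) (x∈p-y⇒x≢y z∈)
  y∈[p∪q]-x : y ∈ (p ∪ q) - x
  y∈[p∪q]-x = x∈p∧x≢y⇒x∈p-y (q⊆p∪q p q y∈q) λ { refl → y∉p x∈p }

p⊆q∧∣q∣≤∣p∣⇒q⊆p : p ⊆ q → ∣ q ∣ ≤ ∣ p ∣ → q ⊆ p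
p⊆q∧∣q∣≤∣p∣⇒q⊆p {p = p} p⊆q ∣q∣≤∣p∣ {x} x∈q = decidable-stable (x ∈? p) λ x∉p →
  <⇒≱ (p⊂q⇒∣p∣<∣q∣ (p⊆q , x , x∈q , x∉p)) ∣q∣≤∣p∣

injection⇒∣p∣≤∣q∣ : ∀ {m} (p : Subset m) (q : Subset n) (f : ∀ {x} → x ∈ p → Fin n) →
  (∀ {x} (x∈p : x ∈ p) → f x∈p ∈ q) →
  (∀ {x y} (x∈p : x ∈ p) (y∈p : y ∈ p) → f x∈p ≡ f y∈p → x ≡ y) → ∣ p ∣ ≤ ∣ q ∣
injection⇒∣p∣≤∣q∣ []            q f into inj = z≤n
injection⇒∣p∣≤∣q∣ (outside ∷ p) q f into inj =
  injection⇒∣p∣≤∣q∣ p q (f ∘ there) (into ∘ there) λ x∈p y∈p → Fin.suc-injective ∘ inj (there x∈p) (there y∈p)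
injection⇒∣p∣≤∣q∣ (inside ∷ p)  q f into inj = ≤-trans (s≤s ∣p∣≤∣q-f₀∣) (x∈p⇒∣p-x∣<∣p∣ (into here))
  where
  f∘there∈q-f₀ : ∀ {x} (x∈p : x ∈ p) → f (there x∈p) ∈ q - f here
  f∘there∈q-f₀ x∈p = x∈p∧x≢y⇒x∈p-y (into (there x∈p)) (Fin.0≢1+n ∘ sym ∘ inj (there x∈p) here)
  ∣p∣≤∣q-f₀∣ : ∣ p ∣ ≤ ∣ q - f here ∣
  ∣p∣≤∣q-f₀∣ = injection⇒∣p∣≤∣q∣ p (q - f here) (f ∘ there) f∘there∈q-f₀
                 λ x∈p y∈p → Fin.suc-injective ∘ inj (there x∈p) (there y∈p)

0<∣p∣⇒nonempty : ∀ (p : Subset n) → 0 < ∣ p ∣ → Nonempty p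
0<∣p∣⇒nonempty {n} p 0<∣p∣ with nonempty? p
... | yes ne    = ne
... | no  empty = contradiction (trans (cong ∣_∣ (Empty-unique empty)) (∣⊥∣≡0 n)) (>⇒≢ 0<∣p∣)

x∈p⇒0<∣p∣ : x ∈ p → 0 < ∣ p ∣
x∈p⇒0<∣p∣ x∈p = ≤-trans (s≤s z≤n) (x∈p⇒∣p-x∣<∣p∣ x∈p)

∣p∣≤1⇒x≡y : ∣ p ∣ ≤ 1 → x ∈ p → y ∈ p → x ≡ y
∣p∣≤1⇒x≡y {x = x} {y = y} ∣p∣≤1 x∈p y∈p = decidable-stable (x Fin.≟ y) λ x≢y →
  <⇒≱ (≤-trans (s≤s (x∈p⇒0<∣p∣ (x∈p∧x≢y⇒x∈p-y y∈p (x≢y ∘ sym)))) (x∈p⇒∣p-x∣<∣p∣ x∈p)) ∣p∣≤1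

∣p∣≤2⇒x≡a⊎x≡b : ∀ {a b} → ∣ p ∣ ≤ 2 → a ∈ p → b ∈ p → a ≢ b → x ∈ p → x ≡ a ⊎ x ≡ b
∣p∣≤2⇒x≡a⊎x≡b {p = p} {x = x} {a = a} ∣p∣≤2 a∈p b∈p a≢b x∈p with x Fin.≟ a
... | yes x≡a = inj₁ x≡a
... | no  x≢a = inj₂ (∣p∣≤1⇒x≡y ∣p-a∣≤1 (x∈p∧x≢y⇒x∈p-y x∈p x≢a) (x∈p∧x≢y⇒x∈p-y b∈p (a≢b ∘ sym)))
  where
  ∣p-a∣≤1 : ∣ p - a ∣ ≤ 1
  ∣p-a∣≤1 = ≤-pred (≤-trans (x∈p⇒∣p-x∣<∣p∣ a∈p) ∣p∣≤2)

2≤∣p∣⇒distinct : ∀ (p : Subset n) → 2 ≤ ∣ p ∣ → ∃[ a ] ∃[ b ] (a ∈ p × b ∈ p × a ≢ b)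
2≤∣p∣⇒distinct p 2≤∣p∣ =
  let a , a∈p   = 0<∣p∣⇒nonempty p (≤-trans (s≤s z≤n) 2≤∣p∣)
      b , b∈p-a = 0<∣p∣⇒nonempty (p - a) (≤-pred (≤-trans 2≤∣p∣ (∣p∣≤1+∣p-x∣ p a)))
  in a , b , a∈p , p─q⊆p p ⁅ a ⁆ b∈p-a , x∈p-y⇒x≢y b∈p-a ∘ sym

∣p∣≡2⇒pair : ∀ (p : Subset n) → ∣ p ∣ ≡ 2 →
  ∃[ a ] ∃[ b ] (a ∈ p × b ∈ p × (∀ {x} → x ∈ p → x ≡ a ⊎ x ≡ b))
∣p∣≡2⇒pair p ∣p∣≡2 =
  let a , b , a∈p , b∈p , a≢b = 2≤∣p∣⇒distinct p (≤-reflexive (sym ∣p∣≡2))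
  in a , b , a∈p , b∈p , ∣p∣≤2⇒x≡a⊎x≡b (≤-reflexive ∣p∣≡2) a∈p b∈p a≢b

3≤∣p∣⇒third : ∀ (p : Subset n) a b → 3 ≤ ∣ p ∣ → ∃[ x ] (x ∈ p × x ≢ a × x ≢ b)
3≤∣p∣⇒third p a b 3≤∣p∣ =
  let x , x∈p-a-b = 0<∣p∣⇒nonempty (p - a - b) 0<∣p-a-b∣
      x∈p-a       = p─q⊆p (p - a) ⁅ b ⁆ x∈p-a-b
  in x , p─q⊆p p ⁅ a ⁆ x∈p-a , x∈p-y⇒x≢y x∈p-a , x∈p-y⇒x≢y x∈p-a-b
  where
  0<∣p-a-b∣ : 0 < ∣ p - a - b ∣
  0<∣p-a-b∣ = ≤-pred (≤-pred (≤-trans 3≤∣p∣ (≤-trans (∣p∣≤1+∣p-x∣ p a) (s≤s (∣p∣≤1+∣p-x∣ (p - a) b)))))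

∈unionOver⁻ : ∀ {m n} (c : Fin m → Subset n) (A : Subset m) {e} →
  e ∈ unionOver c A → ∃[ i ] (i ∈ A × e ∈ c i)
∈unionOver⁻ {zero}  c []           e∈ = contradiction e∈ ∉⊥
∈unionOver⁻ {suc m} c (inside ∷ A) e∈ with x∈p∪q⁻ (c zero) _ e∈
... | inj₁ e∈c0 = zero , here , e∈c0
... | inj₂ e∈U with ∈unionOver⁻ (c ∘ suc) A e∈U
...   | i , i∈A , e∈ci = suc i , there i∈A , e∈ci
∈unionOver⁻ {suc m} c (outside ∷ A) e∈ with x∈p∪q⁻ ∅ _ e∈
... | inj₁ e∈∅ = contradiction e∈∅ ∉⊥
... | inj₂ e∈U with ∈unionOver⁻ (c ∘ suc) A e∈U
...   | i , i∈A , e∈ci = suc i , there i∈A , e∈ci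

∈unionOver⁺ : ∀ {m n} (c : Fin m → Subset n) {A i e} → i ∈ A → e ∈ c i → e ∈ unionOver c A
∈unionOver⁺ c {inside ∷ A}  here        e∈ci = p⊆p∪q _ e∈ci
∈unionOver⁺ c {_ ∷ A}       (there i∈A) e∈ci = q⊆p∪q _ _ (∈unionOver⁺ (c ∘ suc) i∈A e∈ci)

unionOver-mono : ∀ {m n} (c : Fin m → Subset n) {A A'} → A ⊆ A' → unionOver c A ⊆ unionOver c A'
unionOver-mono c A⊆A' e∈ with ∈unionOver⁻ c _ e∈
... | i , i∈A , e∈ci = ∈unionOver⁺ c (A⊆A' i∈A) e∈ci

module MatroidTheory {n : ℕ} (M : Matroid n) where

  private
    c = circ M

  U : Subset (m M) → Subset n
  U = unionOver c

  circuit⊆U : ∀ {A i} → i ∈ A → c i ⊆ U A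
  circuit⊆U i∈A = ∈unionOver⁺ c i∈A

  dependent? : ∀ S → Dec (Dependent M S)
  dependent? S = Fin.any? (λ i → c i ⊆? S)

  independent-⊆ : ∀ {I J} → I ⊆ J → Independent M J → Independent M I
  independent-⊆ I⊆J indepJ (i , ci⊆I) = indepJ (i , I⊆J ∘ ci⊆I)

  ∅-independent : Independent M ∅
  ∅-independent (i , ci⊆∅) with C1 M i
  ... | x , x∈ci = ∉⊥ (ci⊆∅ x∈ci)

  record Basis (S : Subset n) : Set where
    field
      B           : Subset n
      B⊆S         : B ⊆ S
      independent : Independent M B
      maximum     : ∀ J → J ⊆ S → Independent M J → ∣ J ∣ ≤ ∣ B ∣

  rank-exists : ∀ S → ∃[ k ] IsRank M S k
  rank-exists S = search n λ k n<k (I , _ , _ , ∣I∣≡k) → <⇒≱ n<k (subst (_≤ n) ∣I∣≡k (∣p∣≤n I))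
    where
    HasIndependentOfSize : ℕ → Set
    HasIndependentOfSize k = ∃[ I ] (I ⊆ S × Independent M I × ∣ I ∣ ≡ k)

    search : ∀ j → (∀ k → j < k → ¬ HasIndependentOfSize k) → ∃[ k ] IsRank M S k
    search j none-above
      with anySubset? (λ I → (I ⊆? S) ×-dec (¬? (dependent? I)) ×-dec (∣ I ∣ ≟ j))
    ... | yes found = j , found , λ I I⊆S indep →
            ≮⇒≥ λ j<∣I∣ → none-above ∣ I ∣ j<∣I∣ (I , I⊆S , indep , refl)
    search zero    none-above | no none = ⊥-elim (none (∅ , ⊥⊆ , ∅-independent , ∣⊥∣≡0 n))
    search (suc j) none-above | no none = search j none-above'
      where
      none-above' : ∀ k → j < k → ¬ HasIndependentOfSize k
      none-above' k j<k with k ≟ suc j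
      ... | yes refl  = none
      ... | no  k≢1+j = none-above k (≤∧≢⇒< j<k (k≢1+j ∘ sym))

  -- For a basis B of U A, the nullity η(U A) is ∣ U A ─ B ∣.
  𝒜₀⇒basis : ∀ {A} → 𝒜₀ M A → Σ (Basis (U A)) λ β → ∣ U A ─ Basis.B β ∣ < ∣ A ∣
  𝒜₀⇒basis {A} (k , ((B , B⊆U , indep , ∣B∣≡k) , max) , ∣U∣∸k<∣A∣) = β , ∣U─B∣<∣A∣
    where
    β : Basis (U A)
    β = record
      { B = B ; B⊆S = B⊆U ; independent = indep
      ; maximum = λ J J⊆U indepJ → subst (∣ J ∣ ≤_) (sym ∣B∣≡k) (max J J⊆U indepJ) }
    ∣U─B∣<∣A∣ : ∣ U A ─ B ∣ < ∣ A ∣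
    ∣U─B∣<∣A∣ = subst (_< ∣ A ∣) (sym (trans (q⊆p⇒∣p─q∣≡∣p∣∸∣q∣ B⊆U) (cong (∣ U A ∣ ∸_) ∣B∣≡k)))
                  ∣U∣∸k<∣A∣

  ∉𝒜₀⇒∣A∣≤∣U─I∣ : ∀ {A} → ¬ 𝒜₀ M A → ∀ I → Independent M I → ∣ A ∣ ≤ ∣ U A ─ I ∣
  ∉𝒜₀⇒∣A∣≤∣U─I∣ {A} ∉𝒜₀ I indep with rank-exists (U A)
  ... | k , rank@(_ , max) = begin
    ∣ A ∣                   ≤⟨ ≮⇒≥ (λ ∣U∣∸k<∣A∣ → ∉𝒜₀ (k , rank , ∣U∣∸k<∣A∣)) ⟩
    ∣ U A ∣ ∸ k             ≤⟨ ∸-monoʳ-≤ ∣ U A ∣ (max (U A ∩ I) (p∩q⊆p _ _) (independent-⊆ (p∩q⊆q _ _) indep)) ⟩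
    ∣ U A ∣ ∸ ∣ U A ∩ I ∣   ≡⟨ ∣p─q∣≡∣p∣∸∣p∩q∣ (U A) I ⟨
    ∣ U A ─ I ∣             ∎
    where open ≤-Reasoning

  circuit-elim-avoids : ∀ {i j k e} → c k ⊆ (c i ∪ c j) - e → e ∉ c k
  circuit-elim-avoids k⊆ e∈ck = x∈p-y⇒x≢y (k⊆ e∈ck) refl

  circuit-elim-⊆∪ : ∀ {i j k e x} → c k ⊆ (c i ∪ c j) - e → x ∈ c k → x ∈ c i ⊎ x ∈ c j
  circuit-elim-⊆∪ {i} {j} {e = e} k⊆ x∈ck = x∈p∪q⁻ (c i) (c j) (p─q⊆p _ ⁅ e ⁆ (k⊆ x∈ck))

  ⊆B∪⁅e⁆⇒e∈ : ∀ {B i e} → Independent M B → c i ⊆ B ∪ ⁅ e ⁆ → e ∈ c i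
  ⊆B∪⁅e⁆⇒e∈ {i = i} {e} indep ci⊆ with e ∈? c i
  ... | yes e∈ci = e∈ci
  ... | no  e∉ci = ⊥-elim (indep (i , λ x∈ci → x∈p∪⁅y⁆∧x≢y⇒x∈p (ci⊆ x∈ci) λ { refl → e∉ci x∈ci }))

  fundamental-circuit-unique : ∀ {B i j e} → Independent M B →
    c i ⊆ B ∪ ⁅ e ⁆ → c j ⊆ B ∪ ⁅ e ⁆ → i ≡ j
  fundamental-circuit-unique {B} {i} {j} {e} indep ci⊆ cj⊆ with i Fin.≟ j
  ... | yes i≡j = i≡j
  ... | no  i≢j with C3 M i j e i≢j (⊆B∪⁅e⁆⇒e∈ indep ci⊆) (⊆B∪⁅e⁆⇒e∈ indep cj⊆)
  ...   | k , k⊆ = ⊥-elim (indep (k , ck⊆B))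
    where
    ck⊆B : c k ⊆ B
    ck⊆B x∈ck with circuit-elim-⊆∪ k⊆ x∈ck
    ... | inj₁ x∈ci = x∈p∪⁅y⁆∧x≢y⇒x∈p (ci⊆ x∈ci) (x∈p-y⇒x≢y (k⊆ x∈ck))
    ... | inj₂ x∈cj = x∈p∪⁅y⁆∧x≢y⇒x∈p (cj⊆ x∈cj) (x∈p-y⇒x≢y (k⊆ x∈ck))

  fundamental-circuit : ∀ {S} (β : Basis S) {e} → e ∈ S → e ∉ Basis.B β → ∃[ i ] c i ⊆ Basis.B β ∪ ⁅ e ⁆
  fundamental-circuit {S} β {e} e∈S e∉B with dependent? (B ∪ ⁅ e ⁆)
    where open Basis β
  ... | yes dep = dep
  ... | no  indep = contradiction (maximum _ B∪e⊆S indep) (<⇒≱ (x∉p⇒∣p∣<∣p∪⁅x⁆∣ e∉B))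
    where
    open Basis β
    B∪e⊆S : B ∪ ⁅ e ⁆ ⊆ S
    B∪e⊆S x∈ with x∈p∪q⁻ B ⁅ e ⁆ x∈
    ... | inj₁ x∈B = B⊆S x∈B
    ... | inj₂ x∈e = subst (_∈ S) (sym (x∈⁅y⁆⇒x≡y e x∈e)) e∈S

  circuit⊈independent : ∀ {I} → Independent M I → ∀ i → ∃[ x ] (x ∈ c i × x ∉ I)
  circuit⊈independent {I} indep i with Fin.any? (λ x → (x ∈? c i) ×-dec ¬? (x ∈? I))
  ... | yes found = found
  ... | no  none  = ⊥-elim (indep (i , λ {x} x∈ci → decidable-stable (x ∈? I) λ x∉I → none (x , x∈ci , x∉I)))

  nullity≤1⇒circuit-unique : ∀ {I V i j} → Independent M I → ∣ V ─ I ∣ ≤ 1 →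
    c i ⊆ V → c j ⊆ V → i ≡ j
  nullity≤1⇒circuit-unique {I} {V} {i} {j} indep ∣V─I∣≤1 ci⊆V cj⊆V with i Fin.≟ j
  ... | yes i≡j = i≡j
  ... | no  i≢j with circuit⊈independent indep i | circuit⊈independent indep j
  ...   | x , x∈ci , x∉I | x' , x'∈cj , x'∉I with C3 M i j x i≢j x∈ci x∈cj
    where
    x∈cj : x ∈ c j
    x∈cj = subst (_∈ c j) (∣p∣≤1⇒x≡y ∣V─I∣≤1 (x∈p∧x∉q⇒x∈p─q (cj⊆V x'∈cj) x'∉I)
                                            (x∈p∧x∉q⇒x∈p─q (ci⊆V x∈ci) x∉I)) x'∈cj
  ...     | k , k⊆ = ⊥-elim (indep (k , ck⊆I))
    where
    ck⊆V : c k ⊆ V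
    ck⊆V y∈ck = [ ci⊆V , cj⊆V ]′ (circuit-elim-⊆∪ k⊆ y∈ck)
    ck⊆I : c k ⊆ I
    ck⊆I {y} y∈ck = decidable-stable (y ∈? I) λ y∉I → x∈p-y⇒x≢y (k⊆ y∈ck)
      (∣p∣≤1⇒x≡y ∣V─I∣≤1 (x∈p∧x∉q⇒x∈p─q (ck⊆V y∈ck) y∉I) (x∈p∧x∉q⇒x∈p─q (ci⊆V x∈ci) x∉I))

  𝒜₀⇒3≤∣A∣ : ∀ {A} → 𝒜₀ M A → 3 ≤ ∣ A ∣
  𝒜₀⇒3≤∣A∣ {A} A∈𝒜₀ = ≰⇒> λ ∣A∣≤2 →
    let a , b , a∈A , b∈A , a≢b = 2≤∣p∣⇒distinct A 2≤∣A∣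
    in a≢b (nullity≤1⇒circuit-unique independent (≤-pred (≤-trans ∣N∣<∣A∣ ∣A∣≤2))
                                     (circuit⊆U a∈A) (circuit⊆U b∈A))
    where
    β : Basis (U A)
    β = proj₁ (𝒜₀⇒basis A∈𝒜₀)
    ∣N∣<∣A∣ : ∣ U A ─ Basis.B β ∣ < ∣ A ∣
    ∣N∣<∣A∣ = proj₂ (𝒜₀⇒basis A∈𝒜₀)
    open Basis β
    2≤∣A∣ : 2 ≤ ∣ A ∣
    2≤∣A∣ =
      let i , i∈A = 0<∣p∣⇒nonempty A (≤-trans (s≤s z≤n) ∣N∣<∣A∣)
          x , x∈ci , x∉B = circuit⊈independent independent i
      in ≤-trans (s≤s (x∈p⇒0<∣p∣ (x∈p∧x∉q⇒x∈p─q (circuit⊆U i∈A x∈ci) x∉B))) ∣N∣<∣A∣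

  δDependent⇒3≤∣A∣ : ∀ {A} → δDependent M A → 3 ≤ ∣ A ∣
  δDependent⇒3≤∣A∣ (i , A∈𝒜ᵢ) = 𝒜ᵢ⇒3≤∣A∣ i A∈𝒜ᵢ
    where
    𝒜ᵢ⇒3≤∣A∣ : ∀ i {A} → 𝒜 M i A → 3 ≤ ∣ A ∣
    𝒜ᵢ⇒3≤∣A∣ zero    A∈𝒜₀ = 𝒜₀⇒3≤∣A∣ A∈𝒜₀
    𝒜ᵢ⇒3≤∣A∣ (suc i) (A' , A'⊆A , inj₁ A'∈𝒜ᵢ) = ≤-trans (𝒜ᵢ⇒3≤∣A∣ i A'∈𝒜ᵢ) (p⊆q⇒∣p∣≤∣q∣ A'⊆A)
    𝒜ᵢ⇒3≤∣A∣ (suc i) (_ , A'⊆A , inj₂ (A₁ , A₂ , v , A₁∈𝒜ᵢ , A₂∈𝒜ᵢ , A₁∩A₂∉𝒜ᵢ , v∈A₁ , v∈A₂ , refl)) =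
      ≤-trans (𝒜ᵢ⇒3≤∣A∣ i A₁∈𝒜ᵢ) (≤-trans ∣A₁∣≤∣[A₁∪A₂]-v∣ (p⊆q⇒∣p∣≤∣q∣ A'⊆A))
      where
      ∣A₁∣≤∣[A₁∪A₂]-v∣ : ∣ A₁ ∣ ≤ ∣ (A₁ ∪ A₂) - v ∣
      ∣A₁∣≤∣[A₁∪A₂]-v∣ with Fin.any? (λ w → (w ∈? A₂) ×-dec ¬? (w ∈? A₁))
      ... | yes (w , w∈A₂ , w∉A₁) = ∣p∣≤∣[p∪q]-x∣ v∈A₁ w∈A₂ w∉A₁
      ... | no  none = ⊥-elim (A₁∩A₂∉𝒜ᵢ (subst (𝒜 M i) (sym A₁∩A₂≡A₂) A₂∈𝒜ᵢ))
        where
        A₁∩A₂≡A₂ : A₁ ∩ A₂ ≡ A₂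
        A₁∩A₂≡A₂ = ⊆-antisym (p∩q⊆q A₁ A₂) λ {w} w∈A₂ →
          x∈p∩q⁺ (decidable-stable (w ∈? A₁) (λ w∉A₁ → none (w , w∈A₂ , w∉A₁)) , w∈A₂)

record IsTheta {n} (M : Matroid n) (X : Subset (m M)) : Set where
  field
    covered   : ∀ {x e} → x ∈ X → e ∈ circ M x → ∃[ x' ] (x' ∈ X × x' ≢ x × e ∈ circ M x')
    no-common : ∀ {e} → ¬ (∀ {x} → x ∈ X → e ∈ circ M x)

record ThetaHub {n} (M : Matroid n) (z r r̄ : Fin (m M)) : Set where
  field
    z≢r       : z ≢ r
    z≢r̄       : z ≢ r̄
    covered   : ∀ {y} → y ∈ circ M z → y ∈ circ M r ⊎ y ∈ circ M r̄
    no-triple : ∀ {y} → y ∈ circ M z → y ∈ circ M r → y ∈ circ M r̄ → ⊥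

record TwoThetas {n} (M : Matroid n) : Set where
  field
    z r r̄ s s̄      : Fin (m M)
    θr             : ThetaHub M z r r̄
    θs             : ThetaHub M z s s̄
    all-circuits   : ∀ k → k ≡ z ⊎ (k ≡ r ⊎ k ≡ r̄) ⊎ (k ≡ s ⊎ k ≡ s̄)
    sides-disjoint : ∀ {k} → k ≡ r ⊎ k ≡ r̄ → k ≡ s ⊎ k ≡ s̄ → ⊥

module _ {n} {M : Matroid n} where

  open MatroidTheory M using (circuit-elim-avoids; circuit-elim-⊆∪)

  private
    c = circ M

  IsTheta⇒ThetaHub : ∀ {X z r r̄} → IsTheta M X → z ∈ X → r ∈ X - z → r̄ ∈ X - z →
    (∀ {x} → x ∈ X - z → x ≡ r ⊎ x ≡ r̄) → ThetaHub M z r r̄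
  IsTheta⇒ThetaHub {X} {z} {r} {r̄} θ z∈X r∈X-z r̄∈X-z X-z⊆rr̄ = record
    { z≢r       = x∈p-y⇒x≢y r∈X-z ∘ sym
    ; z≢r̄       = x∈p-y⇒x≢y r̄∈X-z ∘ sym
    ; covered   = covered
    ; no-triple = no-triple }
    where
    covered : ∀ {y} → y ∈ c z → y ∈ c r ⊎ y ∈ c r̄
    covered y∈z with IsTheta.covered θ z∈X y∈z
    ... | x , x∈X , x≢z , y∈x with X-z⊆rr̄ (x∈p∧x≢y⇒x∈p-y x∈X x≢z)
    ...   | inj₁ refl = inj₁ y∈x
    ...   | inj₂ refl = inj₂ y∈x
    no-triple : ∀ {y} → y ∈ c z → y ∈ c r → y ∈ c r̄ → ⊥
    no-triple {y} y∈z y∈r y∈r̄ = IsTheta.no-common θ y∈X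
      where
      y∈X : ∀ {x} → x ∈ X → y ∈ c x
      y∈X {x} x∈X with x Fin.≟ z
      ... | yes refl = y∈z
      ... | no  x≢z with X-z⊆rr̄ (x∈p∧x≢y⇒x∈p-y x∈X x≢z)
      ...   | inj₁ refl = y∈r
      ...   | inj₂ refl = y∈r̄

  ThetaHub-swap : ∀ {z r r̄} → ThetaHub M z r r̄ → ThetaHub M z r̄ r
  ThetaHub-swap θ = record
    { z≢r = z≢r̄ ; z≢r̄ = z≢r ; covered = swap ∘′ covered
    ; no-triple = λ y∈z y∈r̄ y∈r → no-triple y∈z y∈r y∈r̄ }
    where open ThetaHub θ

  ThetaHub-meets : ∀ {z r r̄} → ThetaHub M z r r̄ → ∃[ u ] (u ∈ c z × u ∈ c r̄)
  ThetaHub-meets {z} {r} {r̄} θ with Fin.any? (λ u → (u ∈? c z) ×-dec (u ∈? c r̄))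
  ... | yes meet = meet
  ... | no  none = ⊥-elim (z≢r (C2 M z r z⊆r))
    where
    open ThetaHub θ
    z⊆r : c z ⊆ c r
    z⊆r {u} u∈z with covered u∈z
    ... | inj₁ u∈r = u∈r
    ... | inj₂ u∈r̄ = ⊥-elim (none (u , u∈z , u∈r̄))

  swap-r : TwoThetas M → TwoThetas M
  swap-r T = record
    { z = z ; r = r̄ ; r̄ = r ; s = s ; s̄ = s̄ ; θr = ThetaHub-swap θr ; θs = θs
    ; all-circuits = map₂ (map₁ swap) ∘ all-circuits
    ; sides-disjoint = sides-disjoint ∘ swap }
    where open TwoThetas T

  swap-sides : TwoThetas M → TwoThetas M
  swap-sides T = record
    { z = z ; r = s ; r̄ = s̄ ; s = r ; s̄ = r̄ ; θr = θs ; θs = θr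
    ; all-circuits = map₂ swap ∘ all-circuits
    ; sides-disjoint = λ k∈s k∈r → sides-disjoint k∈r k∈s }
    where open TwoThetas T

  swap-s : TwoThetas M → TwoThetas M
  swap-s = swap-sides ∘ swap-r ∘ swap-sides

  eliminate-at-hub : (T : TwoThetas M) → let open TwoThetas T in ∀ {y} → y ∈ c z → y ∈ c r → y ∈ c s →
    (∀ {u} → u ∈ c r̄ → u ∈ c z → u ∈ c s) ⊎ (∀ {u} → u ∈ c s̄ → u ∈ c z → u ∈ c r)
  -- The circuit obtained by eliminating y from r and s misses y, so it is r̄ or s̄.
  eliminate-at-hub T {y} y∈z y∈r y∈s
    with C3 M r s y (λ r≡s → sides-disjoint (inj₁ refl) (inj₁ r≡s)) y∈r y∈s
    where open TwoThetas T
  ... | k , k⊆ with TwoThetas.all-circuits T k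
  ...   | inj₁ refl               = ⊥-elim (circuit-elim-avoids k⊆ y∈z)
  ...   | inj₂ (inj₁ (inj₁ refl)) = ⊥-elim (circuit-elim-avoids k⊆ y∈r)
  ...   | inj₂ (inj₂ (inj₁ refl)) = ⊥-elim (circuit-elim-avoids k⊆ y∈s)
  ...   | inj₂ (inj₁ (inj₂ refl)) = inj₁ λ u∈r̄ u∈z → r̄-case u∈z (circuit-elim-⊆∪ k⊆ u∈r̄) u∈r̄
    where
    open TwoThetas T
    r̄-case : ∀ {u} → u ∈ c z → u ∈ c r ⊎ u ∈ c s → u ∈ c r̄ → u ∈ c s
    r̄-case u∈z (inj₁ u∈r) u∈r̄ = ⊥-elim (ThetaHub.no-triple θr u∈z u∈r u∈r̄)
    r̄-case u∈z (inj₂ u∈s) _   = u∈s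
  ...   | inj₂ (inj₂ (inj₂ refl)) = inj₂ λ u∈s̄ u∈z → s̄-case u∈z (circuit-elim-⊆∪ k⊆ u∈s̄) u∈s̄
    where
    open TwoThetas T
    s̄-case : ∀ {u} → u ∈ c z → u ∈ c r ⊎ u ∈ c s → u ∈ c s̄ → u ∈ c r
    s̄-case u∈z (inj₁ u∈r) _   = u∈r
    s̄-case u∈z (inj₂ u∈s) u∈s̄ = ⊥-elim (ThetaHub.no-triple θs u∈z u∈s u∈s̄)

  r̄∩z⊆s⇒⊥ : (T : TwoThetas M) → let open TwoThetas T in (∀ {u} → u ∈ c r̄ → u ∈ c z → u ∈ c s) → ⊥
  r̄∩z⊆s⇒⊥ T r̄∩z⊆s with ThetaHub-meets (TwoThetas.θr T)
  ... | u , u∈z , u∈r̄ with eliminate-at-hub (swap-r T) u∈z u∈r̄ (r̄∩z⊆s u∈r̄ u∈z)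
  ...   | inj₁ r∩z⊆s = ThetaHub.z≢r θs (C2 M z s z⊆s)
    where
    open TwoThetas T
    z⊆s : c z ⊆ c s
    z⊆s y∈z with ThetaHub.covered θr y∈z
    ... | inj₁ y∈r = r∩z⊆s y∈r y∈z
    ... | inj₂ y∈r̄ = r̄∩z⊆s y∈r̄ y∈z
  ...   | inj₂ s̄∩z⊆r̄ with ThetaHub-meets (TwoThetas.θs T)
  ...     | v , v∈z , v∈s̄ = ThetaHub.no-triple θs v∈z (r̄∩z⊆s (s̄∩z⊆r̄ v∈s̄ v∈z) v∈z) v∈s̄
    where open TwoThetas T

  hub-element-in-r∩s⇒⊥ : (T : TwoThetas M) → let open TwoThetas T in ∀ {y} → y ∈ c z → y ∈ c r → y ∈ c s → ⊥
  hub-element-in-r∩s⇒⊥ T y∈z y∈r y∈s with eliminate-at-hub T y∈z y∈r y∈s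
  ... | inj₁ r̄∩z⊆s = r̄∩z⊆s⇒⊥ T r̄∩z⊆s
  ... | inj₂ s̄∩z⊆r = r̄∩z⊆s⇒⊥ (swap-sides T) s̄∩z⊆r

  no-two-thetas : TwoThetas M → ⊥
  no-two-thetas T with C1 M (TwoThetas.z T)
  ... | y , y∈z with ThetaHub.covered θr y∈z | ThetaHub.covered θs y∈z
    where open TwoThetas T
  ... | inj₁ y∈r | inj₁ y∈s = hub-element-in-r∩s⇒⊥ T y∈z y∈r y∈s
  ... | inj₁ y∈r | inj₂ y∈s̄ = hub-element-in-r∩s⇒⊥ (swap-s T) y∈z y∈r y∈s̄
  ... | inj₂ y∈r̄ | inj₁ y∈s = hub-element-in-r∩s⇒⊥ (swap-r T) y∈z y∈r̄ y∈s
  ... | inj₂ y∈r̄ | inj₂ y∈s̄ = hub-element-in-r∩s⇒⊥ (swap-r (swap-s T)) y∈z y∈r̄ y∈s̄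

  two-theta-circuits⇒⊥ : ∀ {X Y} → IsTheta M X → IsTheta M Y → ∣ X ∣ ≡ 3 → ∣ Y ∣ ≡ 3 →
    Nonempty (X ∩ Y) → ∣ X ∩ Y ∣ ≤ 1 → (∀ k → k ∈ X ⊎ k ∈ Y) → ⊥
  two-theta-circuits⇒⊥ {X} {Y} θX θY ∣X∣≡3 ∣Y∣≡3 (z , z∈X∩Y) ∣X∩Y∣≤1 X∪Y-all =
    let r , r̄ , r∈ , r̄∈ , X-z⊆ = ∣p∣≡2⇒pair (X - z) (suc-injective (trans (sym (x∈p⇒∣p∣≡1+∣p-x∣ z∈X)) ∣X∣≡3))
        s , s̄ , s∈ , s̄∈ , Y-z⊆ = ∣p∣≡2⇒pair (Y - z) (suc-injective (trans (sym (x∈p⇒∣p∣≡1+∣p-x∣ z∈Y)) ∣Y∣≡3))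
    in no-two-thetas record
      { z = z ; r = r ; r̄ = r̄ ; s = s ; s̄ = s̄
      ; θr = IsTheta⇒ThetaHub θX z∈X r∈ r̄∈ X-z⊆
      ; θs = IsTheta⇒ThetaHub θY z∈Y s∈ s̄∈ Y-z⊆
      ; all-circuits = all-circuits X-z⊆ Y-z⊆
      ; sides-disjoint = λ k∈rr̄ k∈ss̄ → sides-disjoint (in-side r∈ r̄∈ k∈rr̄) (in-side s∈ s̄∈ k∈ss̄) }
    where
    z∈X : z ∈ X
    z∈X = proj₁ (x∈p∩q⁻ X Y z∈X∩Y)
    z∈Y : z ∈ Y
    z∈Y = proj₂ (x∈p∩q⁻ X Y z∈X∩Y)
    all-circuits : ∀ {r r̄ s s̄} → (∀ {x} → x ∈ X - z → x ≡ r ⊎ x ≡ r̄) → (∀ {x} → x ∈ Y - z → x ≡ s ⊎ x ≡ s̄) →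
      ∀ k → k ≡ z ⊎ (k ≡ r ⊎ k ≡ r̄) ⊎ (k ≡ s ⊎ k ≡ s̄)
    all-circuits X-z⊆ Y-z⊆ k with k Fin.≟ z | X∪Y-all k
    ... | yes k≡z | _        = inj₁ k≡z
    ... | no  k≢z | inj₁ k∈X = inj₂ (inj₁ (X-z⊆ (x∈p∧x≢y⇒x∈p-y k∈X k≢z)))
    ... | no  k≢z | inj₂ k∈Y = inj₂ (inj₂ (Y-z⊆ (x∈p∧x≢y⇒x∈p-y k∈Y k≢z)))
    in-side : ∀ {P k a b} → a ∈ P - z → b ∈ P - z → k ≡ a ⊎ k ≡ b → k ∈ P - z
    in-side a∈ b∈ (inj₁ refl) = a∈
    in-side a∈ b∈ (inj₂ refl) = b∈
    sides-disjoint : ∀ {k} → k ∈ X - z → k ∈ Y - z → ⊥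
    sides-disjoint k∈X-z k∈Y-z =
      x∈p-y⇒x≢y k∈X-z (∣p∣≤1⇒x≡y ∣X∩Y∣≤1 (x∈p∩q⁺ (p─q⊆p X _ k∈X-z , p─q⊆p Y _ k∈Y-z)) z∈X∩Y)

AtMostOneOutside : ∀ {n} → Subset n → Subset n → Set
AtMostOneOutside X Y = ∀ {w w'} → w ∈ Y → w ∉ X → w' ∈ Y → w' ∉ X → w ≡ w'

allBut⇒atMostOneOutside : ∀ {n} {X Y : Subset n} v → (∀ {x} → x ∈ Y → x ≢ v → x ∈ X) → AtMostOneOutside X Y
allBut⇒atMostOneOutside {X = X} {Y} v in-X w∈Y w∉X w'∈Y w'∉X = trans (≡v w∈Y w∉X) (sym (≡v w'∈Y w'∉X))
  where
  ≡v : ∀ {w} → w ∈ Y → w ∉ X → w ≡ v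
  ≡v {w} w∈Y w∉X = decidable-stable (w Fin.≟ v) (w∉X ∘ in-X w∈Y)

Isolated : ∀ {n} (M : Matroid n) → Subset (m M) → Set
Isolated M X = ∀ Y → ¬ X ⊆ Y → AtMostOneOutside X Y → ¬ 𝒜₀ M Y

module IsolatedCircuit {n} (M : Matroid n) {X : Subset (m M)}
  (X∈𝒜₀ : 𝒜₀ M X) (isolated : Isolated M X) (3≤∣X∣ : 3 ≤ ∣ X ∣) where

  open MatroidTheory M
  private
    c = circ M

  β : Basis (U X)
  β = proj₁ (𝒜₀⇒basis X∈𝒜₀)

  open Basis β

  N : Subset n
  N = U X ─ B

  ∣N∣<∣X∣ : ∣ N ∣ < ∣ X ∣
  ∣N∣<∣X∣ = proj₂ (𝒜₀⇒basis X∈𝒜₀)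

  ∣Y∣≤∣U[Y]─B∣ : ∀ {Y} → ¬ X ⊆ Y → AtMostOneOutside X Y → ∣ Y ∣ ≤ ∣ U Y ─ B ∣
  ∣Y∣≤∣U[Y]─B∣ X⊈Y near-X = ∉𝒜₀⇒∣A∣≤∣U─I∣ (isolated _ X⊈Y near-X) B independent

  U[Y]─B⊆N : ∀ {Y} → U Y ⊆ U X → U Y ─ B ⊆ N
  U[Y]─B⊆N UY⊆UX x∈ = x∈p∧x∉q⇒x∈p─q (UY⊆UX (p─q⊆p _ B x∈)) (x∈p─q⇒x∉q x∈)

  X-h⊆X : ∀ h → X - h ⊆ X
  X-h⊆X h = p─q⊆p X ⁅ h ⁆

  module _ {h} (h∈X : h ∈ X) where

    ∣X-h∣≤∣U[X-h]─B∣ : ∣ X - h ∣ ≤ ∣ U (X - h) ─ B ∣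
    ∣X-h∣≤∣U[X-h]─B∣ = ∣Y∣≤∣U[Y]─B∣ (λ X⊆X-h → x∈p-y⇒x≢y (X⊆X-h h∈X) refl)
                                     (λ w∈ w∉X → ⊥-elim (w∉X (X-h⊆X h w∈)))

    N⊆U[X-h] : N ⊆ U (X - h)
    N⊆U[X-h] = p─q⊆p _ B ∘ p⊆q∧∣q∣≤∣p∣⇒q⊆p (U[Y]─B⊆N (unionOver-mono c (X-h⊆X h))) ∣N∣≤∣U[X-h]─B∣
      where
      ∣N∣≤∣U[X-h]─B∣ : ∣ N ∣ ≤ ∣ U (X - h) ─ B ∣
      ∣N∣≤∣U[X-h]─B∣ = ≤-trans (≤-pred (≤-trans ∣N∣<∣X∣ (∣p∣≤1+∣p-x∣ X h))) ∣X-h∣≤∣U[X-h]─B∣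

    ∣X∣≤1+∣N∣ : ∣ X ∣ ≤ suc ∣ N ∣
    ∣X∣≤1+∣N∣ = ≤-trans (∣p∣≤1+∣p-x∣ X h)
                  (s≤s (≤-trans ∣X-h∣≤∣U[X-h]─B∣ (p⊆q⇒∣p∣≤∣q∣ (U[Y]─B⊆N (unionOver-mono c (X-h⊆X h))))))

  X-nonempty : Nonempty X
  X-nonempty = 0<∣p∣⇒nonempty X (≤-trans (s≤s z≤n) 3≤∣X∣)

  ∣X∣≡1+∣N∣ : ∣ X ∣ ≡ suc ∣ N ∣
  ∣X∣≡1+∣N∣ = ≤-antisym (∣X∣≤1+∣N∣ (proj₂ X-nonempty)) ∣N∣<∣X∣

  circuit⊆UX⇒∈X : ∀ {w} → c w ⊆ U X → w ∈ X
  circuit⊆UX⇒∈X {w} cw⊆UX with w ∈? X | X-nonempty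
  ... | yes w∈X | _ = w∈X
  ... | no  w∉X | h , h∈X = contradiction (≤-trans ∣X∣≤∣Y∣ ∣Y∣≤∣N∣) (<⇒≱ ∣N∣<∣X∣)
    where
    Y : Subset (m M)
    Y = (X - h) ∪ ⁅ w ⁆
    h∉Y : h ∉ Y
    h∉Y h∈Y = x∈p-y⇒x≢y (x∈p∪⁅y⁆∧x≢y⇒x∈p h∈Y λ { refl → w∉X h∈X }) refl
    UY⊆UX : U Y ⊆ U X
    UY⊆UX e∈ with ∈unionOver⁻ c Y e∈
    ... | i , i∈Y , e∈ci with x∈p∪q⁻ (X - h) ⁅ w ⁆ i∈Y
    ...   | inj₁ i∈X-h = circuit⊆U (X-h⊆X h i∈X-h) e∈ci
    ...   | inj₂ i∈w   = cw⊆UX (subst (λ j → _ ∈ c j) (x∈⁅y⁆⇒x≡y w i∈w) e∈ci)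
    ∣Y∣≤∣N∣ : ∣ Y ∣ ≤ ∣ N ∣
    ∣Y∣≤∣N∣ = ≤-trans (∣Y∣≤∣U[Y]─B∣ (λ X⊆Y → h∉Y (X⊆Y h∈X))
                        (allBut⇒atMostOneOutside w λ x∈Y x≢w → X-h⊆X h (x∈p∪⁅y⁆∧x≢y⇒x∈p x∈Y x≢w)))
                      (p⊆q⇒∣p∣≤∣q∣ (U[Y]─B⊆N UY⊆UX))
    ∣X∣≤∣Y∣ : ∣ X ∣ ≤ ∣ Y ∣
    ∣X∣≤∣Y∣ = ≤-trans (∣p∣≤1+∣p-x∣ X h) (x∉p⇒∣p∣<∣p∪⁅x⁆∣ (w∉X ∘ X-h⊆X h))

  module _ {e} (e∈N : e ∈ N) where

    fund : Fin (m M)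
    fund = proj₁ (fundamental-circuit β (p─q⊆p _ B e∈N) (x∈p─q⇒x∉q e∈N))

    fund⊆B∪e : c fund ⊆ B ∪ ⁅ e ⁆
    fund⊆B∪e = proj₂ (fundamental-circuit β (p─q⊆p _ B e∈N) (x∈p─q⇒x∉q e∈N))

    e∈fund : e ∈ c fund
    e∈fund = ⊆B∪⁅e⁆⇒e∈ independent fund⊆B∪e

    fund∈X : fund ∈ X
    fund∈X = circuit⊆UX⇒∈X λ x∈ → [ B⊆S , (λ x∈e → subst (_∈ U X) (sym (x∈⁅y⁆⇒x≡y e x∈e)) (p─q⊆p _ B e∈N)) ]′
                                      (x∈p∪q⁻ B ⁅ e ⁆ (fund⊆B∪e x∈))

    ∈fund∩N⇒≡e : ∀ {x} → x ∈ c fund → x ∈ N → x ≡ e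
    ∈fund∩N⇒≡e x∈fund x∈N = x∈p∪⁅y⁆∧x∉p⇒x≡y (fund⊆B∪e x∈fund) (x∈p─q⇒x∉q x∈N)

    fund-unique : ∀ {i} → c i ⊆ B ∪ ⁅ e ⁆ → i ≡ fund
    fund-unique ci⊆ = fundamental-circuit-unique independent ci⊆ fund⊆B∪e

  fund-≡ : ∀ {e e'} (e∈N : e ∈ N) (e'∈N : e' ∈ N) → e ≡ e' → fund e∈N ≡ fund e'∈N
  fund-≡ e∈N e'∈N refl = fund-unique e'∈N (fund⊆B∪e e∈N)

  ∈fund⇒fund≡ : ∀ {e e'} (e∈N : e ∈ N) (e'∈N : e' ∈ N) → e' ∈ c (fund e∈N) → fund e'∈N ≡ fund e∈N
  ∈fund⇒fund≡ e∈N e'∈N e'∈fund = fund-≡ e'∈N e∈N (∈fund∩N⇒≡e e∈N e'∈fund e'∈N)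

  fund-injective : ∀ {e e'} (e∈N : e ∈ N) (e'∈N : e' ∈ N) → fund e∈N ≡ fund e'∈N → e ≡ e'
  fund-injective e∈N e'∈N fund≡ = sym (∈fund∩N⇒≡e e∈N (subst (λ i → _ ∈ c i) (sym fund≡) (e∈fund e'∈N)) e'∈N)

  NonFundamental : Fin (m M) → Set
  NonFundamental x = ∀ {e} (e∈N : e ∈ N) → x ≢ fund e∈N

  nonFundamental-unique : ∀ {d d'} → d ∈ X → d' ∈ X → NonFundamental d → NonFundamental d' → d ≡ d'
  nonFundamental-unique {d} {d'} d∈X d'∈X d-nf d'-nf with d Fin.≟ d'
  ... | yes d≡d' = d≡d'
  ... | no  d≢d' = ⊥-elim $ 1+n≰n $ begin
    suc (suc ∣ X - d - d' ∣)  ≤⟨ 2+∣X-d-d'∣≤∣X∣ ⟩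
    ∣ X ∣                     ≡⟨ ∣X∣≡1+∣N∣ ⟩
    suc ∣ N ∣                 ≤⟨ s≤s ∣N∣≤∣X-d-d'∣ ⟩
    suc ∣ X - d - d' ∣        ∎
    where
    open ≤-Reasoning
    d'∈X-d : d' ∈ X - d
    d'∈X-d = x∈p∧x≢y⇒x∈p-y d'∈X (d≢d' ∘ sym)
    2+∣X-d-d'∣≤∣X∣ : suc (suc ∣ X - d - d' ∣) ≤ ∣ X ∣
    2+∣X-d-d'∣≤∣X∣ = ≤-trans (s≤s (x∈p⇒∣p-x∣<∣p∣ d'∈X-d)) (x∈p⇒∣p-x∣<∣p∣ d∈X)
    fund∈X-d-d' : ∀ {e} (e∈N : e ∈ N) → fund e∈N ∈ X - d - d'
    fund∈X-d-d' e∈N = x∈p∧x≢y⇒x∈p-y (x∈p∧x≢y⇒x∈p-y (fund∈X e∈N) (d-nf e∈N ∘ sym)) (d'-nf e∈N ∘ sym)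
    ∣N∣≤∣X-d-d'∣ : ∣ N ∣ ≤ ∣ X - d - d' ∣
    ∣N∣≤∣X-d-d'∣ = injection⇒∣p∣≤∣q∣ N (X - d - d') fund fund∈X-d-d' fund-injective

  abstract
    N-covered-by-nonFundamental : ∀ {e} → e ∈ N → ∃[ x ] (x ∈ X × NonFundamental x × e ∈ c x)
    N-covered-by-nonFundamental e∈N with ∈unionOver⁻ c (X - fund e∈N) (N⊆U[X-h] (fund∈X e∈N) e∈N)
    ... | x , x∈X-f , e∈cx = x , p─q⊆p X _ x∈X-f , x-nf , e∈cx
      where
      x-nf : NonFundamental x
      x-nf e'∈N refl = x∈p-y⇒x≢y x∈X-f (sym (∈fund⇒fund≡ e'∈N e∈N e∈cx))

    N-nonempty : Nonempty N
    N-nonempty = 0<∣p∣⇒nonempty N (≤-trans (s≤s z≤n) (≤-pred (subst (3 ≤_) ∣X∣≡1+∣N∣ 3≤∣X∣)))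

  private
    d-covering : ∃[ x ] (x ∈ X × NonFundamental x × proj₁ N-nonempty ∈ c x)
    d-covering = N-covered-by-nonFundamental (proj₂ N-nonempty)

  d : Fin (m M)
  d = proj₁ d-covering

  d∈X : d ∈ X
  d∈X = proj₁ (proj₂ d-covering)

  d-nonFundamental : NonFundamental d
  d-nonFundamental = proj₁ (proj₂ (proj₂ d-covering))

  N⊆d : N ⊆ c d
  N⊆d e∈N with N-covered-by-nonFundamental e∈N
  ... | x , x∈X , x-nf , e∈cx = subst (λ i → _ ∈ c i) (nonFundamental-unique x∈X d∈X x-nf d-nonFundamental) e∈cx

  X-elements : ∀ {x} → x ∈ X → x ≡ d ⊎ ∃[ e ] Σ (e ∈ N) λ e∈N → x ≡ fund e∈N
  X-elements {x} x∈X with Fin.any? (λ e → (e ∈? N) ×-dec (c x ⊆? B ∪ ⁅ e ⁆))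
  ... | yes (e , e∈N , cx⊆) = inj₂ (e , e∈N , fund-unique e∈N cx⊆)
  ... | no  none = inj₁ (nonFundamental-unique x∈X d∈X x-nf d-nonFundamental)
    where
    x-nf : NonFundamental x
    x-nf {e} e∈N refl = none (e , e∈N , fund⊆B∪e e∈N)

  circuit-elim-∈X : ∀ {a b k y} → a ∈ X → b ∈ X → c k ⊆ (c a ∪ c b) - y → k ∈ X
  circuit-elim-∈X a∈X b∈X k⊆ = circuit⊆UX⇒∈X λ x∈ck → [ circuit⊆U a∈X , circuit⊆U b∈X ]′ (circuit-elim-⊆∪ k⊆ x∈ck)

  module _ (4≤∣X∣ : 4 ≤ ∣ X ∣) where

    3≤∣N∣ : 3 ≤ ∣ N ∣
    3≤∣N∣ = ≤-pred (subst (4 ≤_) ∣X∣≡1+∣N∣ 4≤∣X∣)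

    fund-disjoint : ∀ {e e' y} (e∈N : e ∈ N) (e'∈N : e' ∈ N) → e ≢ e' →
      y ∈ c (fund e∈N) → y ∈ c (fund e'∈N) → ⊥
    fund-disjoint {e} {e'} {y} e∈N e'∈N e≢e' y∈f y∈f'
      with C3 M _ _ y (e≢e' ∘ fund-injective e∈N e'∈N) y∈f y∈f'
    ... | k , k⊆ with X-elements (circuit-elim-∈X (fund∈X e∈N) (fund∈X e'∈N) k⊆)
    ...   | inj₁ refl with 3≤∣p∣⇒third N e e' 3≤∣N∣
    ...     | e₃ , e₃∈N , e₃≢e , e₃≢e' with circuit-elim-⊆∪ k⊆ (N⊆d e₃∈N)
    ...       | inj₁ e₃∈f  = e₃≢e (∈fund∩N⇒≡e e∈N e₃∈f e₃∈N)
    ...       | inj₂ e₃∈f' = e₃≢e' (∈fund∩N⇒≡e e'∈N e₃∈f' e₃∈N)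
    fund-disjoint {y = y} e∈N e'∈N e≢e' y∈f y∈f' | k , k⊆ | inj₂ (e'' , e''∈N , refl)
      with circuit-elim-⊆∪ k⊆ (e∈fund e''∈N)
    ... | inj₁ e''∈f  = circuit-elim-avoids k⊆ (subst (λ i → y ∈ c i) (sym (∈fund⇒fund≡ e∈N e''∈N e''∈f)) y∈f)
    ... | inj₂ e''∈f' = circuit-elim-avoids k⊆ (subst (λ i → y ∈ c i) (sym (∈fund⇒fund≡ e'∈N e''∈N e''∈f')) y∈f')

    no-large-isolated-circuit : ⊥
    no-large-isolated-circuit with N-nonempty
    ... | e₀ , e₀∈N with C3 M d (fund e₀∈N) e₀ (d-nonFundamental e₀∈N) (N⊆d e₀∈N) (e∈fund e₀∈N)
    ...   | k , k⊆ with X-elements (circuit-elim-∈X d∈X (fund∈X e₀∈N) k⊆)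
    ...     | inj₁ refl = circuit-elim-avoids k⊆ (N⊆d e₀∈N)
    ...     | inj₂ (e' , e'∈N , refl) = d-nonFundamental e'∈N (sym (C2 M _ d ck⊆cd))
      where
      e'≢e₀ : e' ≢ e₀
      e'≢e₀ refl = circuit-elim-avoids k⊆ (e∈fund e'∈N)
      ck⊆cd : c (fund e'∈N) ⊆ c d
      ck⊆cd x∈ck with circuit-elim-⊆∪ k⊆ x∈ck
      ... | inj₁ x∈d  = x∈d
      ... | inj₂ x∈f₀ = ⊥-elim (fund-disjoint e'∈N e₀∈N e'≢e₀ x∈ck x∈f₀)

  module TwoNonbasisElements (∣N∣≤2 : ∣ N ∣ ≤ 2) {a b} (a∈N : a ∈ N) (b∈N : b ∈ N) (a≢b : a ≢ b) where

    fa fb : Fin (m M)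
    fa = fund a∈N
    fb = fund b∈N

    X-elements₃ : ∀ {x} → x ∈ X → x ≡ d ⊎ x ≡ fa ⊎ x ≡ fb
    X-elements₃ x∈X with X-elements x∈X
    ... | inj₁ x≡d = inj₁ x≡d
    ... | inj₂ (e , e∈N , x≡f) with ∣p∣≤2⇒x≡a⊎x≡b ∣N∣≤2 a∈N b∈N a≢b e∈N
    ...   | inj₁ e≡a = inj₂ (inj₁ (trans x≡f (fund-≡ e∈N a∈N e≡a)))
    ...   | inj₂ e≡b = inj₂ (inj₂ (trans x≡f (fund-≡ e∈N b∈N e≡b)))

    fa⊆d∪fb : ∀ {y} → y ∈ c fa → y ∈ c d ⊎ y ∈ c fb
    fa⊆d∪fb y∈fa with C3 M d fb b (d-nonFundamental b∈N) (N⊆d b∈N) (e∈fund b∈N)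
    ... | k , k⊆ with X-elements₃ (circuit-elim-∈X d∈X (fund∈X b∈N) k⊆)
    ...   | inj₁ refl        = ⊥-elim (circuit-elim-avoids k⊆ (N⊆d b∈N))
    ...   | inj₂ (inj₁ refl) = circuit-elim-⊆∪ k⊆ y∈fa
    ...   | inj₂ (inj₂ refl) = ⊥-elim (circuit-elim-avoids k⊆ (e∈fund b∈N))

  module _ (∣N∣≤2 : ∣ N ∣ ≤ 2) {a b} (a∈N : a ∈ N) (b∈N : b ∈ N) (a≢b : a ≢ b) where

    private
      module AB = TwoNonbasisElements ∣N∣≤2 a∈N b∈N a≢b
      module BA = TwoNonbasisElements ∣N∣≤2 b∈N a∈N (a≢b ∘ sym)
    open AB using (fa; fb; X-elements₃)

    fa≢fb : fa ≢ fb
    fa≢fb = a≢b ∘ fund-injective a∈N b∈N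

    d⊆fa∪fb : ∀ {y} → y ∈ c d → y ∈ c fa ⊎ y ∈ c fb
    d⊆fa∪fb y∈d with Fin.any? (λ z → (z ∈? c fa) ×-dec (z ∈? c fb))
    ... | yes (z , z∈fa , z∈fb) with C3 M fa fb z fa≢fb z∈fa z∈fb
    ...   | k , k⊆ with X-elements₃ (circuit-elim-∈X (fund∈X a∈N) (fund∈X b∈N) k⊆)
    ...     | inj₁ refl        = circuit-elim-⊆∪ k⊆ y∈d
    ...     | inj₂ (inj₁ refl) = ⊥-elim (circuit-elim-avoids k⊆ z∈fa)
    ...     | inj₂ (inj₂ refl) = ⊥-elim (circuit-elim-avoids k⊆ z∈fb)
    d⊆fa∪fb y∈d | no disjoint = ⊥-elim (d-nonFundamental b∈N (sym (C2 M fb d fb⊆d)))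
      where
      fb⊆d : c fb ⊆ c d
      fb⊆d {x} x∈fb with BA.fa⊆d∪fb x∈fb
      ... | inj₁ x∈d  = x∈d
      ... | inj₂ x∈fa = ⊥-elim (disjoint (x , x∈fa , x∈fb))

    covered : ∀ {x e} → x ∈ X → e ∈ c x → ∃[ x' ] (x' ∈ X × x' ≢ x × e ∈ c x')
    covered x∈X e∈cx with X-elements₃ x∈X
    ... | inj₁ refl = [ (λ e∈fa → fa , fund∈X a∈N , d-nonFundamental a∈N ∘ sym , e∈fa)
                      , (λ e∈fb → fb , fund∈X b∈N , d-nonFundamental b∈N ∘ sym , e∈fb) ]′ (d⊆fa∪fb e∈cx)
    ... | inj₂ (inj₁ refl) = [ (λ e∈d → d , d∈X , d-nonFundamental a∈N , e∈d)
                             , (λ e∈fb → fb , fund∈X b∈N , fa≢fb ∘ sym , e∈fb) ]′ (AB.fa⊆d∪fb e∈cx)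
    ... | inj₂ (inj₂ refl) = [ (λ e∈d → d , d∈X , d-nonFundamental b∈N , e∈d)
                             , (λ e∈fa → fa , fund∈X a∈N , fa≢fb , e∈fa) ]′ (BA.fa⊆d∪fb e∈cx)

    no-common : ∀ {e} → ¬ (∀ {x} → x ∈ X → e ∈ c x)
    no-common e∈all with C3 M fa fb _ fa≢fb (e∈all (fund∈X a∈N)) (e∈all (fund∈X b∈N))
    ... | k , k⊆ = circuit-elim-avoids k⊆ (e∈all (circuit-elim-∈X (fund∈X a∈N) (fund∈X b∈N) k⊆))

    theta : IsTheta M X
    theta = record { covered = covered ; no-common = no-common }

  ∣X∣≡3⇒∣N∣≡2 : ∣ X ∣ ≡ 3 → ∣ N ∣ ≡ 2
  ∣X∣≡3⇒∣N∣≡2 ∣X∣≡3 = suc-injective (trans (sym ∣X∣≡1+∣N∣) ∣X∣≡3)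

  isolated-circuit-of-size-3-is-theta : ∣ X ∣ ≡ 3 → IsTheta M X
  isolated-circuit-of-size-3-is-theta ∣X∣≡3 = theta-of-pair (2≤∣p∣⇒distinct N (≤-reflexive (sym ∣N∣≡2)))
    where
    ∣N∣≡2 : ∣ N ∣ ≡ 2
    ∣N∣≡2 = ∣X∣≡3⇒∣N∣≡2 ∣X∣≡3
    theta-of-pair : ∃[ a ] ∃[ b ] (a ∈ N × b ∈ N × a ≢ b) → IsTheta M X
    theta-of-pair (a , b , a∈N , b∈N , a≢b) = theta (≤-reflexive ∣N∣≡2) a∈N b∈N a≢b

module CircuitWithOppositePair {n} (M : Matroid n) {X Q : Subset (m M)}
  (Q∩X≡∅ : ∀ {x} → x ∈ Q → x ∉ X) (2≤∣Q∣ : 2 ≤ ∣ Q ∣)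
  (⊇X⊎⊇Q : ∀ {A} → δDependent M A → X ⊆ A ⊎ Q ⊆ A) (X-dependent : δDependent M X) where

  open MatroidTheory M using (δDependent⇒3≤∣A∣)

  δDependent-near-X⇒⊇X : ∀ {A} → δDependent M A → AtMostOneOutside X A → X ⊆ A
  δDependent-near-X⇒⊇X A-dep one-outside with ⊇X⊎⊇Q A-dep | 2≤∣p∣⇒distinct Q 2≤∣Q∣
  ... | inj₁ X⊆A | _ = X⊆A
  ... | inj₂ Q⊆A | a , b , a∈Q , b∈Q , a≢b =
    ⊥-elim (a≢b (one-outside (Q⊆A a∈Q) (Q∩X≡∅ a∈Q) (Q⊆A b∈Q) (Q∩X≡∅ b∈Q)))

  isolated : Isolated M X
  isolated Y X⊈Y one-outside Y∈𝒜₀ = X⊈Y (δDependent-near-X⇒⊇X (zero , Y∈𝒜₀) one-outside)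

  𝒜ᵢ∧⊆X⇒𝒜₀ : ∀ i {A} → 𝒜 M i A → A ⊆ X → 𝒜₀ M A
  𝒜ᵢ∧⊆X⇒𝒜₀ zero A∈𝒜₀ _ = A∈𝒜₀
  𝒜ᵢ∧⊆X⇒𝒜₀ (suc i) {A} (A' , A'⊆A , inj₁ A'∈𝒜ᵢ) A⊆X = subst (𝒜₀ M) A'≡A A'∈𝒜₀
    where
    A'∈𝒜₀ : 𝒜₀ M A'
    A'∈𝒜₀ = 𝒜ᵢ∧⊆X⇒𝒜₀ i A'∈𝒜ᵢ (⊆-trans A'⊆A A⊆X)
    X⊆A' : X ⊆ A'
    X⊆A' = δDependent-near-X⇒⊇X (zero , A'∈𝒜₀) λ w∈A' w∉X → ⊥-elim (w∉X (A⊆X (A'⊆A w∈A')))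
    A'≡A : A' ≡ A
    A'≡A = ⊆-antisym A'⊆A (⊆-trans A⊆X X⊆A')
  𝒜ᵢ∧⊆X⇒𝒜₀ (suc i) (_ , A'⊆A , inj₂ (A₁ , A₂ , v , A₁∈𝒜ᵢ , A₂∈𝒜ᵢ , A₁∩A₂∉𝒜ᵢ , v∈A₁ , v∈A₂ , refl)) A⊆X =
    ⊥-elim (A₁∩A₂∉𝒜ᵢ (subst (𝒜 M i) (sym A₁∩A₂≡A₁) A₁∈𝒜ᵢ))
    where
    X⊆A₂ : X ⊆ A₂
    X⊆A₂ = δDependent-near-X⇒⊇X (i , A₂∈𝒜ᵢ) (allBut⇒atMostOneOutside v λ x∈A₂ x≢v →
             A⊆X (A'⊆A (x∈p∧x≢y⇒x∈p-y (q⊆p∪q A₁ A₂ x∈A₂) x≢v)))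
    A₁⊆A₂ : A₁ ⊆ A₂
    A₁⊆A₂ {x} x∈A₁ with x Fin.≟ v
    ... | yes refl = v∈A₂
    ... | no  x≢v  = X⊆A₂ (A⊆X (A'⊆A (x∈p∧x≢y⇒x∈p-y (p⊆p∪q A₂ x∈A₁) x≢v)))
    A₁∩A₂≡A₁ : A₁ ∩ A₂ ≡ A₁
    A₁∩A₂≡A₁ = ⊆-antisym (p∩q⊆p A₁ A₂) λ x∈A₁ → x∈p∩q⁺ (x∈A₁ , A₁⊆A₂ x∈A₁)

  X∈𝒜₀ : 𝒜₀ M X
  X∈𝒜₀ = 𝒜ᵢ∧⊆X⇒𝒜₀ (proj₁ X-dependent) (proj₂ X-dependent) ⊆-refl

  private
    3≤∣X∣ : 3 ≤ ∣ X ∣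
    3≤∣X∣ = δDependent⇒3≤∣A∣ X-dependent
    module X = IsolatedCircuit M X∈𝒜₀ isolated 3≤∣X∣

  theta-of-size-3 : ∣ X ∣ ≡ 3 × IsTheta M X
  theta-of-size-3 = ∣X∣≡3 , X.isolated-circuit-of-size-3-is-theta ∣X∣≡3
    where
    ∣X∣≡3 : ∣ X ∣ ≡ 3
    ∣X∣≡3 = ≤-antisym (≮⇒≥ X.no-large-isolated-circuit) 3≤∣X∣

record DerivedTricycle {n} (M : Matroid n) : Set where
  field
    X₁ X₂ X₃           : Subset (m M)
    dependent⇒⊇circuit : ∀ {A} → δDependent M A → X₁ ⊆ A ⊎ X₂ ⊆ A ⊎ X₃ ⊆ A
    X₁-dependent       : δDependent M X₁
    X₂-dependent       : δDependent M X₂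
    X₃-dependent       : δDependent M X₃
    covers₁₂           : ∀ x → x ∈ X₁ ⊎ x ∈ X₂
    covers₁₃           : ∀ x → x ∈ X₁ ⊎ x ∈ X₃
    covers₂₃           : ∀ x → x ∈ X₂ ⊎ x ∈ X₃
    no-common          : ∀ {x} → x ∈ X₁ → x ∈ X₂ → x ∈ X₃ → ⊥
    meets₁₂            : Nonempty (X₁ ∩ X₂)
    meets₁₃            : Nonempty (X₁ ∩ X₃)
    meets₂₃            : Nonempty (X₂ ∩ X₃)

module _ {n} {M : Matroid n} where

  rotate : DerivedTricycle M → DerivedTricycle M
  rotate T = record
    { X₁ = X₂ ; X₂ = X₃ ; X₃ = X₁
    ; dependent⇒⊇circuit = rotate-⊎ ∘ dependent⇒⊇circuit
    ; X₁-dependent = X₂-dependent ; X₂-dependent = X₃-dependent ; X₃-dependent = X₁-dependent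
    ; covers₁₂ = covers₂₃ ; covers₁₃ = swap ∘ covers₁₂ ; covers₂₃ = swap ∘ covers₁₃
    ; no-common = λ x∈X₂ x∈X₃ x∈X₁ → no-common x∈X₁ x∈X₂ x∈X₃
    ; meets₁₂ = meets₂₃
    ; meets₁₃ = subst Nonempty (∩-comm X₁ X₂) meets₁₂
    ; meets₂₃ = subst Nonempty (∩-comm X₁ X₃) meets₁₃ }
    where
    open DerivedTricycle T
    rotate-⊎ : ∀ {A B C : Set} → A ⊎ B ⊎ C → B ⊎ C ⊎ A
    rotate-⊎ (inj₁ a)        = inj₂ (inj₂ a)
    rotate-⊎ (inj₂ (inj₁ b)) = inj₁ b
    rotate-⊎ (inj₂ (inj₂ c)) = inj₂ (inj₁ c)

  module _ (T : DerivedTricycle M) where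
    open DerivedTricycle T

    ∣X₁∣≡∣X₁∩X₂∣+∣X₁∩X₃∣ : ∣ X₁ ∣ ≡ ∣ X₁ ∩ X₂ ∣ + ∣ X₁ ∩ X₃ ∣
    ∣X₁∣≡∣X₁∩X₂∣+∣X₁∩X₃∣ = ∣p∣≡∣p∩q∣+∣p∩r∣ (λ {x} _ → covers₂₃ x) no-common

    X₁-theta : 2 ≤ ∣ X₂ ∩ X₃ ∣ → ∣ X₁ ∣ ≡ 3 × IsTheta M X₁
    X₁-theta 2≤∣X₂∩X₃∣ = CircuitWithOppositePair.theta-of-size-3 M
      (λ x∈X₂∩X₃ x∈X₁ → no-common x∈X₁ (proj₁ (x∈p∩q⁻ X₂ X₃ x∈X₂∩X₃)) (proj₂ (x∈p∩q⁻ X₂ X₃ x∈X₂∩X₃)))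
      2≤∣X₂∩X₃∣ ⊇X₁⊎⊇X₂∩X₃ X₁-dependent
      where
      ⊇X₁⊎⊇X₂∩X₃ : ∀ {A} → δDependent M A → X₁ ⊆ A ⊎ X₂ ∩ X₃ ⊆ A
      ⊇X₁⊎⊇X₂∩X₃ A-dependent with dependent⇒⊇circuit A-dependent
      ... | inj₁ X₁⊆A        = inj₁ X₁⊆A
      ... | inj₂ (inj₁ X₂⊆A) = inj₂ (X₂⊆A ∘ p∩q⊆p X₂ X₃)
      ... | inj₂ (inj₂ X₃⊆A) = inj₂ (X₃⊆A ∘ p∩q⊆q X₂ X₃)

  private
    3≤m+n∧n≤1⇒2≤m : ∀ {m n} → 3 ≤ m + n → n ≤ 1 → 2 ≤ m
    3≤m+n∧n≤1⇒2≤m {m} 3≤m+n n≤1 = ≤-pred (≤-trans 3≤m+n (≤-trans (+-monoʳ-≤ m n≤1) (≤-reflexive (+-comm m 1))))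

    m+n≡3∧2≤m⇒n≤1 : ∀ {m n} → m + n ≡ 3 → 2 ≤ m → n ≤ 1
    m+n≡3∧2≤m⇒n≤1 {n = n} m+n≡3 2≤m = ≤-pred (≤-pred (≤-trans (+-monoˡ-≤ n 2≤m) (≤-reflexive m+n≡3)))

    ∣p∩q∣≡∣q∩p∣ : ∀ {k} (p q : Subset k) → ∣ p ∩ q ∣ ≡ ∣ q ∩ p ∣
    ∣p∩q∣≡∣q∩p∣ p q = cong ∣_∣ (∩-comm p q)

  small-X₂∩X₃⇒⊥ : (T : DerivedTricycle M) → ∣ DerivedTricycle.X₂ T ∩ DerivedTricycle.X₃ T ∣ ≤ 1 → ⊥
  small-X₂∩X₃⇒⊥ T ∣X₂∩X₃∣≤1 =
    two-theta-circuits⇒⊥ (proj₂ X₂-theta) (proj₂ X₃-theta) (proj₁ X₂-theta) (proj₁ X₃-theta)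
                         meets₂₃ ∣X₂∩X₃∣≤1 covers₂₃
    where
    open DerivedTricycle T
    open MatroidTheory M using (δDependent⇒3≤∣A∣)
    2≤∣X₂∩X₁∣ : 2 ≤ ∣ X₂ ∩ X₁ ∣
    2≤∣X₂∩X₁∣ = 3≤m+n∧n≤1⇒2≤m
      (subst (3 ≤_) (trans (∣X₁∣≡∣X₁∩X₂∣+∣X₁∩X₃∣ (rotate T)) (+-comm ∣ X₂ ∩ X₃ ∣ ∣ X₂ ∩ X₁ ∣))
                    (δDependent⇒3≤∣A∣ X₂-dependent))
      ∣X₂∩X₃∣≤1
    2≤∣X₃∩X₁∣ : 2 ≤ ∣ X₃ ∩ X₁ ∣
    2≤∣X₃∩X₁∣ = 3≤m+n∧n≤1⇒2≤m
      (subst (3 ≤_) (∣X₁∣≡∣X₁∩X₂∣+∣X₁∩X₃∣ (rotate (rotate T))) (δDependent⇒3≤∣A∣ X₃-dependent))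
      (subst (_≤ 1) (∣p∩q∣≡∣q∩p∣ X₂ X₃) ∣X₂∩X₃∣≤1)
    X₂-theta : ∣ X₂ ∣ ≡ 3 × IsTheta M X₂
    X₂-theta = X₁-theta (rotate T) 2≤∣X₃∩X₁∣
    X₃-theta : ∣ X₃ ∣ ≡ 3 × IsTheta M X₃
    X₃-theta = X₁-theta (rotate (rotate T)) (subst (2 ≤_) (∣p∩q∣≡∣q∩p∣ X₂ X₁) 2≤∣X₂∩X₁∣)

  no-derived-tricycle : DerivedTricycle M → ⊥
  no-derived-tricycle T with ∣ X₂ ∩ X₃ ∣ ≤? 1 | ∣ X₁ ∩ X₂ ∣ ≤? 1
    where open DerivedTricycle T
  ... | yes ∣X₂∩X₃∣≤1 | _             = small-X₂∩X₃⇒⊥ T ∣X₂∩X₃∣≤1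
  ... | no  _         | yes ∣X₁∩X₂∣≤1 = small-X₂∩X₃⇒⊥ (rotate (rotate T)) ∣X₁∩X₂∣≤1
  ... | no  ∣X₂∩X₃∣≰1 | no  ∣X₁∩X₂∣≰1 = small-X₂∩X₃⇒⊥ (rotate T) ∣X₃∩X₁∣≤1
    where
    open DerivedTricycle T
    ∣X₁∣≡3 : ∣ X₁ ∣ ≡ 3
    ∣X₁∣≡3 = proj₁ (X₁-theta T (≰⇒> ∣X₂∩X₃∣≰1))
    ∣X₃∩X₁∣≤1 : ∣ X₃ ∩ X₁ ∣ ≤ 1
    ∣X₃∩X₁∣≤1 = subst (_≤ 1) (∣p∩q∣≡∣q∩p∣ X₁ X₃)
      (m+n≡3∧2≤m⇒n≤1 (trans (sym (∣X₁∣≡∣X₁∩X₂∣+∣X₁∩X₃∣ T)) ∣X₁∣≡3) (≰⇒> ∣X₁∩X₂∣≰1))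

reindex : ∀ {a b} → (Fin a → Fin b) → Subset b → Subset a
reindex f S = tabulate (lookup S ∘ f)

∈reindex⁻ : ∀ {a b} {f : Fin a → Fin b} {S x} → x ∈ reindex f S → f x ∈ S
∈reindex⁻ {f = f} {S} {x} x∈ =
  lookup⇒[]= (f x) S (trans (sym (lookup∘tabulate (lookup S ∘ f) x)) ([]=⇒lookup x∈))

∈reindex⁺ : ∀ {a b} {f : Fin a → Fin b} {S x} → f x ∈ S → x ∈ reindex f S
∈reindex⁺ {f = f} {S} {x} fx∈ =
  lookup⇒[]= x (reindex f S) (trans (lookup∘tabulate (lookup S ∘ f) x) ([]=⇒lookup fx∈))

module _ {a b} (σ : Fin a ↔ Fin b) where
  open Inverse σ

  preimage : Subset b → Subset a
  preimage = reindex to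

  from∈preimage : ∀ {S e} → e ∈ S → from e ∈ preimage S
  from∈preimage {S} e∈S = ∈reindex⁺ (subst (_∈ S) (sym (strictlyInverseˡ _)) e∈S)

  ⊆image⇒preimage⊆ : ∀ {S A} → S ⊆ image σ A → preimage S ⊆ A
  ⊆image⇒preimage⊆ {A = A} S⊆ {x} x∈ = subst (_∈ A) (strictlyInverseʳ x) (∈reindex⁻ (S⊆ (∈reindex⁻ x∈)))

  preimage⊆⇒⊆image : ∀ {S A} → preimage S ⊆ A → S ⊆ image σ A
  preimage⊆⇒⊆image ⊆A e∈S = ∈reindex⁺ (⊆A (from∈preimage e∈S))

δIsomorphic-tricycle⇒DerivedTricycle : ∀ {k n} {T : Matroid k} {M : Matroid n} →
  IsTricycle T → δIsomorphic M T → DerivedTricycle M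
δIsomorphic-tricycle⇒DerivedTricycle {T = T} {M} (refl , pairwise , no-triple) (σ , δDependent⇔Dependent) =
  record
  { X₁ = X 0F ; X₂ = X 1F ; X₃ = X 2F
  ; dependent⇒⊇circuit = by-index ∘ Equivalence.to (δDependent⇔Dependent _)
  ; X₁-dependent = X-dependent 0F ; X₂-dependent = X-dependent 1F ; X₃-dependent = X-dependent 2F
  ; covers₁₂ = covers 0F 1F (λ ()) ; covers₁₃ = covers 0F 2F (λ ()) ; covers₂₃ = covers 1F 2F (λ ())
  ; no-common = λ x∈X₁ x∈X₂ x∈X₃ →
      no-triple (_ , x∈p∩q⁺ (∈reindex⁻ x∈X₁ , x∈p∩q⁺ (∈reindex⁻ x∈X₂ , ∈reindex⁻ x∈X₃)))
  ; meets₁₂ = meets 0F 1F (λ ()) ; meets₁₃ = meets 0F 2F (λ ()) ; meets₂₃ = meets 1F 2F (λ ()) }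
  where
  pattern 0F = zero
  pattern 1F = suc zero
  pattern 2F = suc (suc zero)
  X : Fin 3 → Subset (m M)
  X i = preimage σ (circ T i)
  by-index : ∀ {A} → Dependent T (image σ A) → X 0F ⊆ A ⊎ X 1F ⊆ A ⊎ X 2F ⊆ A
  by-index (0F , C⊆) = inj₁ (⊆image⇒preimage⊆ σ C⊆)
  by-index (1F , C⊆) = inj₂ (inj₁ (⊆image⇒preimage⊆ σ C⊆))
  by-index (2F , C⊆) = inj₂ (inj₂ (⊆image⇒preimage⊆ σ C⊆))
  X-dependent : ∀ i → δDependent M (X i)
  X-dependent i = Equivalence.from (δDependent⇔Dependent _) (i , preimage⊆⇒⊆image σ ⊆-refl)
  covers : ∀ i j → i ≢ j → ∀ x → x ∈ X i ⊎ x ∈ X j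
  covers i j i≢j x with x∈p∪q⁻ (circ T i) (circ T j) (subst (_ ∈_) (sym (proj₂ (pairwise i j i≢j))) ∈⊤)
  ... | inj₁ ∈Cᵢ = inj₁ (∈reindex⁺ ∈Cᵢ)
  ... | inj₂ ∈Cⱼ = inj₂ (∈reindex⁺ ∈Cⱼ)
  meets : ∀ i j → i ≢ j → Nonempty (X i ∩ X j)
  meets i j i≢j with proj₁ (pairwise i j i≢j)
  ... | e , e∈Cᵢ∩Cⱼ = Inverse.from σ e ,
    x∈p∩q⁺ (from∈preimage σ (proj₁ (x∈p∩q⁻ _ _ e∈Cᵢ∩Cⱼ)) , from∈preimage σ (proj₂ (x∈p∩q⁻ _ _ e∈Cᵢ∩Cⱼ)))

mainTheorem10 : ∀ {k} (T : Matroid k) → IsTricycle T →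
    ∀ {n} (M : Matroid n) → ¬ δIsomorphic M T
mainTheorem10 T tricycle M δM≅T =
  no-derived-tricycle (δIsomorphic-tricycle⇒DerivedTricycle tricycle δM≅T)
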